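{- Let $n$ be a positive integer and let $s\in\{ -2,-1,0,1,2\}$ with $n\ge s$. Then $\operatorname{aw}([3n-s],3)\geq\operatorname{aw}([n],3)+1$.
   Context: $[m]=\{1,\dots,m\}$. A $3$-AP in a set $S$ of integers is a set of three distinct elements $a,a+d,a+2d$ of $S$ with $d\ge1$. An $r$-coloring of $S$ is a map $S\to\{1,\dots,r\}$, exact if surjective; a $3$-AP is rainbow if its three elements receive distinct colors. $\operatorname{aw}(S,3)$ is the smallest $r$ such that every exact $r$-coloring of $S$ contains a rainbow $3$-AP (with $\operatorname{aw}(S,3)=|S|+1$ if $|S|<3$). -}

module Defs where

open import Data.Nat using (ℕ; zero; suc; _+_; _*_; _≤_; _<_)
open import Data.Fin using (Fin; toℕ)
open import Data.Product using (Σ; ∃; _×_; _,_)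
open import Relation.Nullary using (¬_)
open import Relation.Binary.PropositionalEquality using (_≡_; _≢_)

-- [m] = {1,…,m} is represented by Fin m, the element i : Fin m standing for toℕ i + 1
-- (a shift, which preserves arithmetic progressions).

Exact : ∀ {m r} → (Fin m → Fin r) → Set
Exact {m} {r} c = ∀ (k : Fin r) → ∃ λ (i : Fin m) → c i ≡ k

RainbowAP : ∀ {m r} → (Fin m → Fin r) → Set
RainbowAP {m} {r} c =
  Σ (Fin m) λ x → Σ (Fin m) λ y → Σ (Fin m) λ z → Σ ℕ λ d →
    1 ≤ d × toℕ y ≡ toℕ x + d × toℕ z ≡ toℕ x + 2 * d ×
    c x ≢ c y × c x ≢ c z × c y ≢ c z

AllRainbow : ℕ → ℕ → Set
AllRainbow m r = ∀ (c : Fin m → Fin r) → Exact c → RainbowAP c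

-- IsAw m a : a = aw([m],3).  For m ≥ 3 it is the smallest r (r ≥ 1, colours {1..r})
-- such that every exact r-coloring has a rainbow 3-AP; for m < 3 it is m + 1.
IsAw : ℕ → ℕ → Set
IsAw m a with m Data.Nat.<? 3
... | Relation.Nullary.yes _ = a ≡ m + 1
... | Relation.Nullary.no _ =
  1 ≤ a × AllRainbow m a × (∀ r → 1 ≤ r → r < a → ¬ AllRainbow m r)

module Submission where

-- Let N = 3n - s and write [N] as {0,…,N-1}.  For the given s there is a
-- residue ρ ∈ {0,2} such that the class ρ (mod 3) of [N] is exactly
-- {ρ, ρ+3, …, ρ+3(n-1)}, a dilated copy of [n], and the number 1 lies outside it.
-- Given an exact r-colouring c of [n], colour ρ+3j by c(j) and every other point by
-- one fresh colour; this is an exact (r+1)-colouring of [N].  A rainbow 3-AP of it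
-- has at most one fresh colour, and since x, x+d, x+2d are either all congruent
-- mod 3 (when 3 ∣ d) or pairwise incongruent, it lies entirely in the class ρ and
-- so is the image of a rainbow 3-AP of c.  Hence "every exact (r+1)-colouring of
-- [N] is rainbow" implies the same for r-colourings of [n] (`transfer`), and the
-- theorem follows from the defining minimality of aw.

open import Defs
open import Data.Nat using (ℕ; _+_; _≥_; _<_)
open import Data.Integer using (ℤ; +_; -_; _-_; _*_) renaming (_≤_ to _≤ℤ_)
open import Data.Sum using (_⊎_)
open import Relation.Binary.PropositionalEquality using (_≡_)

open import Data.Nat using (zero; suc; _≤_; z≤n; s≤s; _≟_; _<?_; _≤?_; _%_; _/_; _⊓_; NonZero)
  renaming (_*_ to _·_)
open import Data.Nat.Properties
  using (≤-refl; ≤-trans; ≤-pred; ≤-<-trans; ≤⇒≯; ≰⇒>; m≤m+n; m≤n+m; m<m+n;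
         +-comm; *-comm; *-assoc; +-monoˡ-≤; +-monoʳ-≤; +-monoʳ-<; *-monoʳ-≤; *-monoˡ-≤;
         +-cancelʳ-≤; +-cancelʳ-<; +-cancelˡ-<; *-cancelʳ-<; m⊓n≤n; m≤n⇒m⊓n≡m; module ≤-Reasoning)
open import Data.Nat.DivMod
  using (m≡m%n+[m/n]*n; [m+kn]%n≡m%n; %-distribˡ-+; %-distribˡ-*; m<n⇒m%n≡m; m<n⇒m/n≡0;
         m%n<n; +-distrib-/-∣ʳ; m*n/n≡m)
open import Data.Nat.Divisibility using (_∣_; divides; m%n≡0⇒n∣m)
open import Data.Nat.Tactic.RingSolver using (solve-∀)
open import Data.Fin using (Fin; toℕ; fromℕ; fromℕ<; inject₁; lower₁) renaming (zero to fzero)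
open import Data.Fin.Properties
  using (toℕ-injective; toℕ<n; toℕ-fromℕ; toℕ-fromℕ<; inject₁-lower₁; pigeonhole)
  renaming (<-irrefl to <-irreflᶠ)
open import Data.Product using (Σ; _×_; _,_; proj₁; proj₂)
open import Data.Sum using (inj₁; inj₂)
open import Data.Empty using (⊥-elim)
open import Function using (_∘_)
open import Relation.Nullary using (¬_; Dec; yes; no)
open import Relation.Binary.PropositionalEquality
  using (_≢_; refl; sym; trans; cong; subst; subst₂; module ≡-Reasoning)
import Data.Integer as ℤ
import Data.Integer.Properties as ℤP
import Data.Integer.Tactic.RingSolver as ℤSolver

Distinct3 : ℕ → ℕ → ℕ → Set
Distinct3 u v w = u ≢ v × u ≢ w × v ≢ w

multiple-step : ∀ m {x y} k .{{_ : NonZero m}} → y ≡ x + k · m →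
                y % m ≡ x % m × y / m ≡ x / m + k
multiple-step m {x} k refl =
  [m+kn]%n≡m%n x k m , trans (+-distrib-/-∣ʳ x (divides k refl)) (cong (λ q → x / m + q) (m*n/n≡m k m))

residues-distinct : ∀ a e → a < 3 → e < 3 → e ≢ 0 →
                    Distinct3 a ((a + e) % 3) ((a + (2 · e) % 3) % 3)
residues-distinct a 0 _ _ e≢0 = ⊥-elim (e≢0 refl)
residues-distinct 0 1 _ _ _ = (λ ()) , (λ ()) , (λ ())
residues-distinct 0 2 _ _ _ = (λ ()) , (λ ()) , (λ ())
residues-distinct 1 1 _ _ _ = (λ ()) , (λ ()) , (λ ())
residues-distinct 1 2 _ _ _ = (λ ()) , (λ ()) , (λ ())
residues-distinct 2 1 _ _ _ = (λ ()) , (λ ()) , (λ ())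
residues-distinct 2 2 _ _ _ = (λ ()) , (λ ()) , (λ ())
residues-distinct (suc (suc (suc _))) _ (s≤s (s≤s (s≤s ()))) _ _
residues-distinct _ (suc (suc (suc _))) _ (s≤s (s≤s (s≤s ()))) _

ap-residues : ∀ x d {y z} → y ≡ x + d → z ≡ x + 2 · d →
              3 ∣ d ⊎ Distinct3 (x % 3) (y % 3) (z % 3)
ap-residues x d refl refl with d % 3 ≟ 0
... | yes d%3≡0 = inj₁ (m%n≡0⇒n∣m d 3 d%3≡0)
... | no d%3≢0 =
  inj₂ (subst₂ (λ u v → Distinct3 (x % 3) u v) (sym (%-distribˡ-+ x d 3)) (sym z-residue)
          (residues-distinct (x % 3) (d % 3) (m%n<n x 3) (m%n<n d 3) d%3≢0))
  where
  z-residue : (x + 2 · d) % 3 ≡ (x % 3 + (2 · (d % 3)) % 3) % 3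
  z-residue = trans (%-distribˡ-+ x (2 · d) 3) (cong (λ w → (x % 3 + w) % 3) (%-distribˡ-* 2 d 3))

two-differ : ∀ {u v w} ρ → Distinct3 u v w →
             (u ≢ ρ × v ≢ ρ) ⊎ (u ≢ ρ × w ≢ ρ) ⊎ (v ≢ ρ × w ≢ ρ)
two-differ {u} {v} ρ (u≢v , u≢w , v≢w) with u ≟ ρ | v ≟ ρ
... | yes refl | _ = inj₂ (inj₂ ((λ v≡u → u≢v (sym v≡u)) , (λ w≡u → u≢w (sym w≡u))))
... | no u≢ρ | yes refl = inj₂ (inj₁ (u≢ρ , (λ w≡v → v≢w (sym w≡v))))
... | no u≢ρ | no v≢ρ = inj₁ (u≢ρ , v≢ρ)

positive-factor : ∀ {D} → 1 ≤ D · 3 → 1 ≤ D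
positive-factor {suc _} _ = s≤s z≤n

-- The class ρ (mod 3) of {0,…,N-1} is exactly {ρ + 3j | j < n}, and 1 lies outside it.
record ClassLayout (n N : ℕ) : Set where
  field
    ρ : ℕ
    ρ<3 : ρ < 3
    1∉class : 1 % 3 ≢ ρ
    2≤N : 2 ≤ N
    N≤end : N ≤ ρ + n · 3
    end<N+3 : ρ + n · 3 < N + 3

class-element : ∀ {ρ} j → ρ < 3 → (ρ + j · 3) % 3 ≡ ρ × (ρ + j · 3) / 3 ≡ j
class-element {ρ} j ρ<3 with multiple-step 3 {ρ} j refl
... | residue , quotient = trans residue (m<n⇒m%n≡m ρ<3) , trans quotient (cong (_+ j) (m<n⇒m/n≡0 ρ<3))

module _ {n N : ℕ} (L : ClassLayout n N) where
  open ClassLayout L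

  class-index-< : ∀ {i} → i < N → i % 3 ≡ ρ → i / 3 < n
  class-index-< {i} i<N i%3≡ρ = *-cancelʳ-< 3 (i / 3) n (+-cancelˡ-< ρ _ _ (begin-strict
    ρ + i / 3 · 3      ≡⟨ cong (_+ i / 3 · 3) i%3≡ρ ⟨
    i % 3 + i / 3 · 3  ≡⟨ m≡m%n+[m/n]*n i 3 ⟨
    i                  <⟨ i<N ⟩
    N                  ≤⟨ N≤end ⟩
    ρ + n · 3          ∎))
    where open ≤-Reasoning

  class-element-< : ∀ {j} → j < n → ρ + j · 3 < N
  class-element-< {j} j<n = +-cancelʳ-< 3 (ρ + j · 3) N (begin-strict
    ρ + j · 3 + 3      ≡⟨ shift ρ j ⟩
    ρ + suc j · 3      ≤⟨ +-monoʳ-≤ ρ (*-monoˡ-≤ 3 j<n) ⟩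
    ρ + n · 3          <⟨ end<N+3 ⟩
    N + 3              ∎)
    where
    open ≤-Reasoning
    shift : ∀ ρ j → ρ + j · 3 + 3 ≡ ρ + suc j · 3
    shift = solve-∀

module Lift {n N r : ℕ} (L : ClassLayout n N) (c : Fin n → Fin r) where
  open ClassLayout L

  index : ∀ i → toℕ i % 3 ≡ ρ → Fin n
  index i i∈ρ = fromℕ< (class-index-< L (toℕ<n i) i∈ρ)

  toℕ-index : ∀ i i∈ρ → toℕ (index i i∈ρ) ≡ toℕ i / 3
  toℕ-index i i∈ρ = toℕ-fromℕ< (class-index-< L (toℕ<n i) i∈ρ)

  lift : Fin N → Fin (suc r)
  lift i with toℕ i % 3 ≟ ρ
  ... | yes i∈ρ = inject₁ (c (index i i∈ρ))
  ... | no _ = fromℕ r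

  lift-in : ∀ i i∈ρ → lift i ≡ inject₁ (c (index i i∈ρ))
  lift-in i i∈ρ with toℕ i % 3 ≟ ρ
  ... | yes _ = refl
  ... | no i∉ρ = ⊥-elim (i∉ρ i∈ρ)

  lift-out : ∀ i → toℕ i % 3 ≢ ρ → lift i ≡ fromℕ r
  lift-out i i∉ρ with toℕ i % 3 ≟ ρ
  ... | yes i∈ρ = ⊥-elim (i∉ρ i∈ρ)
  ... | no _ = refl

  -- The colour of a point of the class is inherited from its quotient; the fresh
  -- colour is taken at the point 1, and colour k < r at ρ + 3j for any c-preimage j of k.
  lift-exact : Exact c → Exact lift
  lift-exact exact k with r ≟ toℕ k
  ... | yes r≡k =
    fromℕ< 2≤N , trans (lift-out (fromℕ< 2≤N) outside) (toℕ-injective (trans (toℕ-fromℕ r) r≡k))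
    where
    outside : toℕ (fromℕ< 2≤N) % 3 ≢ ρ
    outside rewrite toℕ-fromℕ< 2≤N = 1∉class
  ... | no r≢k = fromℕ< i< , trans (lift-in (fromℕ< i<) i∈ρ) (trans (cong (inject₁ ∘ c) index≡j)
                                   (trans (cong inject₁ cj≡k′) (inject₁-lower₁ k r≢k)))
    where
    k′ : Fin r
    k′ = lower₁ k r≢k
    j : Fin n
    j = proj₁ (exact k′)
    cj≡k′ : c j ≡ k′
    cj≡k′ = proj₂ (exact k′)
    i< : ρ + toℕ j · 3 < N
    i< = class-element-< L (toℕ<n j)
    i∈ρ : toℕ (fromℕ< i<) % 3 ≡ ρ
    i∈ρ = trans (cong (_% 3) (toℕ-fromℕ< i<)) (proj₁ (class-element (toℕ j) ρ<3))
    q≡ : toℕ (fromℕ< i<) / 3 ≡ toℕ j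
    q≡ = trans (cong (_/ 3) (toℕ-fromℕ< i<)) (proj₂ (class-element (toℕ j) ρ<3))
    index≡j : index (fromℕ< i<) i∈ρ ≡ j
    index≡j = toℕ-injective (trans (toℕ-index (fromℕ< i<) i∈ρ) q≡)

  outside-same : ∀ i j → toℕ i % 3 ≢ ρ → toℕ j % 3 ≢ ρ → lift i ≡ lift j
  outside-same i j i∉ρ j∉ρ = trans (lift-out i i∉ρ) (sym (lift-out j j∉ρ))

  index-differ : ∀ i j i∈ρ j∈ρ → lift i ≢ lift j → c (index i i∈ρ) ≢ c (index j j∈ρ)
  index-differ i j i∈ρ j∈ρ i≢j ci≡cj =
    i≢j (trans (lift-in i i∈ρ) (trans (cong inject₁ ci≡cj) (sym (lift-in j j∈ρ))))

  -- A rainbow 3-AP x, x+3D, x+6D of lift: its points share the residue of x, so they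
  -- cannot all lie outside the class (they would share the fresh colour); hence they
  -- are the class points over the 3-AP of indices with difference D.  (Whether x lies
  -- in the class is passed in as a decision, so that splitting on it does not unfold
  -- lift in the hypotheses.)
  aligned-rainbow : ∀ x y z D → 1 ≤ D → toℕ y ≡ toℕ x + D · 3 → toℕ z ≡ toℕ x + (2 · D) · 3 →
                    lift x ≢ lift y → lift x ≢ lift z → lift y ≢ lift z →
                    Dec (toℕ x % 3 ≡ ρ) → RainbowAP c
  aligned-rainbow x y z D 1≤D y≡ z≡ x≢y x≢z y≢z (yes x∈ρ) =
    index x x∈ρ , index y y∈ρ , index z z∈ρ , D , 1≤D ,
    index-step y y∈ρ (proj₂ y-step) , index-step z z∈ρ (proj₂ z-step) ,
    index-differ x y x∈ρ y∈ρ x≢y , index-differ x z x∈ρ z∈ρ x≢z , index-differ y z y∈ρ z∈ρ y≢z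
    where
    y-step : toℕ y % 3 ≡ toℕ x % 3 × toℕ y / 3 ≡ toℕ x / 3 + D
    y-step = multiple-step 3 D y≡
    z-step : toℕ z % 3 ≡ toℕ x % 3 × toℕ z / 3 ≡ toℕ x / 3 + 2 · D
    z-step = multiple-step 3 (2 · D) z≡
    y∈ρ : toℕ y % 3 ≡ ρ
    y∈ρ = trans (proj₁ y-step) x∈ρ
    z∈ρ : toℕ z % 3 ≡ ρ
    z∈ρ = trans (proj₁ z-step) x∈ρ
    index-step : ∀ i i∈ρ {e} → toℕ i / 3 ≡ toℕ x / 3 + e →
                 toℕ (index i i∈ρ) ≡ toℕ (index x x∈ρ) + e
    index-step i i∈ρ {e} i/3≡ =
      trans (toℕ-index i i∈ρ) (trans i/3≡ (cong (_+ e) (sym (toℕ-index x x∈ρ))))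
  aligned-rainbow x y z D _ y≡ _ x≢y _ _ (no x∉ρ) =
    ⊥-elim (x≢y (outside-same x y x∉ρ (x∉ρ ∘ trans (sym (proj₁ (multiple-step 3 D y≡))))))

  -- A rainbow 3-AP of lift has at most one point outside the class, so by
  -- `ap-residues` its difference is a multiple of 3 and `aligned-rainbow` applies.
  lift-rainbow : RainbowAP lift → RainbowAP c
  lift-rainbow (x , y , z , d , 1≤d , y≡ , z≡ , x≢y , x≢z , y≢z) with ap-residues (toℕ x) d y≡ z≡
  ... | inj₁ (divides D refl) =
    aligned-rainbow x y z D (positive-factor 1≤d) y≡
                    (trans z≡ (cong (λ e → toℕ x + e) (sym (*-assoc 2 D 3))))
                    x≢y x≢z y≢z (toℕ x % 3 ≟ ρ)
  ... | inj₂ distinct with two-differ ρ distinct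
  ...   | inj₁ (x∉ρ , y∉ρ) = ⊥-elim (x≢y (outside-same x y x∉ρ y∉ρ))
  ...   | inj₂ (inj₁ (x∉ρ , z∉ρ)) = ⊥-elim (x≢z (outside-same x z x∉ρ z∉ρ))
  ...   | inj₂ (inj₂ (y∉ρ , z∉ρ)) = ⊥-elim (y≢z (outside-same y z y∉ρ z∉ρ))

transfer : ∀ {n N r} → ClassLayout n N → AllRainbow N (suc r) → AllRainbow n r
transfer L all-N c exact = lift-rainbow (all-N lift (lift-exact exact))
  where open Lift L c

no-exact-colouring : ∀ {m r} → m < r → (c : Fin m → Fin r) → ¬ Exact c
no-exact-colouring m<r c exact with pigeonhole m<r (λ k → proj₁ (exact k))
... | k , l , k<l , same-preimage = <-irreflᶠ k≡l k<l
  where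
  k≡l : k ≡ l
  k≡l = trans (sym (proj₂ (exact k))) (trans (cong c same-preimage) (proj₂ (exact l)))

exact-colouring : ∀ {m r} → 1 ≤ r → r ≤ m → Σ (Fin m → Fin r) Exact
exact-colouring {m} {suc r′} _ r≤m = colour , exact
  where
  colour : Fin m → Fin (suc r′)
  colour i = fromℕ< (s≤s (m⊓n≤n (toℕ i) r′))
  exact : Exact colour
  exact k = fromℕ< k<m , toℕ-injective (begin
    toℕ (colour (fromℕ< k<m))  ≡⟨ toℕ-fromℕ< (s≤s (m⊓n≤n (toℕ (fromℕ< k<m)) r′)) ⟩
    toℕ (fromℕ< k<m) ⊓ r′      ≡⟨ cong (_⊓ r′) (toℕ-fromℕ< k<m) ⟩
    toℕ k ⊓ r′                 ≡⟨ m≤n⇒m⊓n≡m (≤-pred (toℕ<n k)) ⟩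
    toℕ k                      ∎)
    where
    open ≡-Reasoning
    k<m : toℕ k < m
    k<m = ≤-trans (toℕ<n k) r≤m

short-no-rainbow : ∀ {m r} (c : Fin m → Fin r) → m < 3 → ¬ RainbowAP c
short-no-rainbow c m<3 (x , y , z , d , 1≤d , _ , z≡ , _) = ≤⇒≯ (≤-pred m<3) (≤-<-trans 2≤z (toℕ<n z))
  where
  2≤z : 2 ≤ toℕ z
  2≤z = subst (2 ≤_) (sym z≡) (≤-trans (*-monoʳ-≤ 2 1≤d) (m≤n+m (2 · d) (toℕ x)))

one-colour-no-rainbow : ∀ {m} (c : Fin m → Fin 1) → ¬ RainbowAP c
one-colour-no-rainbow c (x , y , _ , _ , _ , _ , _ , x≢y , _) with c x | c y
... | fzero | fzero = x≢y refl

data AwCases (m a : ℕ) : Set where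
  short : m < 3 → a ≡ m + 1 → AwCases m a
  long : 1 ≤ a → AllRainbow m a → (∀ r → 1 ≤ r → r < a → ¬ AllRainbow m r) → AwCases m a

aw-cases : ∀ m a → IsAw m a → AwCases m a
aw-cases m a aw with m <? 3
... | yes m<3 = short m<3 aw
... | no _ = long (proj₁ aw) (proj₁ (proj₂ aw)) (proj₂ (proj₂ aw))

aw-all-rainbow : ∀ {m a} → IsAw m a → AllRainbow m a
aw-all-rainbow {m} {a} aw with aw-cases m a aw
... | short _ refl = λ c exact → ⊥-elim (no-exact-colouring (m<m+n m (s≤s z≤n)) c exact)
... | long _ all-a _ = all-a

-- aw([m]) ≥ 2 when m ≥ 1: a single colour is exact and never rainbow.
aw-≥2 : ∀ {m a} → 1 ≤ m → IsAw m a → 2 ≤ a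
aw-≥2 {m} {a} 1≤m aw with aw-cases m a aw
... | short _ refl = +-monoˡ-≤ 1 1≤m
... | long 1≤a all-a _ with a
...   | 1 = ⊥-elim (one-colour-no-rainbow _ (all-a _ (proj₂ (exact-colouring ≤-refl 1≤m))))
...   | suc (suc _) = s≤s (s≤s z≤n)

aw-minimal : ∀ {m b r} → IsAw m b → 1 ≤ r → AllRainbow m r → b ≤ r
aw-minimal {m} {b} {r} aw 1≤r all-r with aw-cases m b aw | r ≤? m
... | short m<3 refl | yes r≤m =
  ⊥-elim (short-no-rainbow _ m<3 (all-r _ (proj₂ (exact-colouring 1≤r r≤m))))
... | short _ refl | no r≰m = subst (_≤ r) (+-comm 1 m) (≰⇒> r≰m)
... | long _ _ minimal | _ with b ≤? r
...   | yes b≤r = b≤r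
...   | no b≰r = ⊥-elim (minimal r 1≤r (≰⇒> b≰r) all-r)

-- The general form: if a residue class mod 3 of [N] avoiding 1 is a dilated copy of
-- [n], then aw([N],3) ≥ aw([n],3) + 1.  Write aw([N],3) = r + 1 with r ≥ 1; by
-- `transfer` every exact r-colouring of [n] is rainbow, so aw([n],3) ≤ r.
aw-lower-bound : ∀ {n N a b} → ClassLayout n N → IsAw N a → IsAw n b → a ≥ b + 1
aw-lower-bound {b = b} L aw-N aw-n with aw-≥2 (≤-trans (s≤s z≤n) (ClassLayout.2≤N L)) aw-N
... | s≤s {n = r} 1≤r = subst (_≤ suc r) (+-comm 1 b) (s≤s b≤r)
  where
  b≤r : b ≤ r
  b≤r = aw-minimal aw-n 1≤r (transfer L (aw-all-rainbow aw-N))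

shifted-size : ∀ n N {ρ t} s → + N ≡ + 3 * + n - s → + ρ - + t ≡ - s → N + t ≡ ρ + 3 · n
shifted-size n N {ρ} {t} s N≡3n-s ρ-t≡-s = ℤP.+-injective (begin
  + (N + t)                         ≡⟨ ℤP.pos-+ N t ⟩
  + N ℤ.+ + t                       ≡⟨ cong (λ e → e ℤ.+ + t) N≡3n-s ⟩
  + 3 * + n - s ℤ.+ + t             ≡⟨ cong (λ e → + 3 * + n ℤ.+ e ℤ.+ + t) ρ-t≡-s ⟨
  + 3 * + n ℤ.+ (+ ρ - + t) ℤ.+ + t ≡⟨ cancel-t (+ 3 * + n) (+ ρ) (+ t) ⟩
  + ρ ℤ.+ + 3 * + n                 ≡⟨ cong (λ e → + ρ ℤ.+ e) (ℤP.pos-* 3 n) ⟨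
  + ρ ℤ.+ + (3 · n)                 ≡⟨ ℤP.pos-+ ρ (3 · n) ⟨
  + (ρ + 3 · n)                     ∎)
  where
  open ≡-Reasoning
  cancel-t : ∀ a p q → a ℤ.+ (p - q) ℤ.+ q ≡ p ℤ.+ a
  cancel-t = ℤSolver.solve-∀

layout : ∀ {n N} ρ t {s} → ρ < 3 → 1 % 3 ≢ ρ → t < 3 → 1 ≤ n → t ≤ ρ + n →
         + N ≡ + 3 * + n - s → + ρ - + t ≡ - s → ClassLayout n N
layout {n} {N} ρ t {s} ρ<3 1∉class t<3 1≤n t≤ρ+n N≡3n-s ρ-t≡-s = record
  { ρ = ρ ; ρ<3 = ρ<3 ; 1∉class = 1∉class
  ; 2≤N = ≤-trans (*-monoʳ-≤ 2 1≤n) 2n≤N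
  ; N≤end = subst (N ≤_) end≡ (m≤m+n N t)
  ; end<N+3 = subst (_< N + 3) end≡ (+-monoʳ-< N t<3)
  }
  where
  N+t≡ : N + t ≡ ρ + 3 · n
  N+t≡ = shifted-size n N {ρ} {t} s N≡3n-s ρ-t≡-s
  end≡ : N + t ≡ ρ + n · 3
  end≡ = trans N+t≡ (cong (λ e → ρ + e) (*-comm 3 n))
  regroup : ∀ ρ n → 2 · n + (ρ + n) ≡ ρ + 3 · n
  regroup = solve-∀
  2n≤N : 2 · n ≤ N
  2n≤N = +-cancelʳ-≤ t (2 · n) N (begin
    2 · n + t        ≤⟨ +-monoʳ-≤ (2 · n) t≤ρ+n ⟩
    2 · n + (ρ + n)  ≡⟨ regroup ρ n ⟩
    ρ + 3 · n        ≡⟨ N+t≡ ⟨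
    N + t            ∎)
    where open ≤-Reasoning

-- For each admissible s, the residue ρ = 2 (s ≤ 0) or ρ = 0 (s > 0) works.
shift-layout : ∀ {n N} s → 0 < n →
               (s ≡ - + 2 ⊎ s ≡ - + 1 ⊎ s ≡ + 0 ⊎ s ≡ + 1 ⊎ s ≡ + 2) →
               s ≤ℤ + n → + N ≡ + 3 * + n - s → ClassLayout n N
shift-layout s 0<n (inj₁ refl) _ N≡ =
  layout 2 0 {s} (s≤s (s≤s (s≤s z≤n))) (λ ()) (s≤s z≤n) 0<n z≤n N≡ refl
shift-layout s 0<n (inj₂ (inj₁ refl)) _ N≡ =
  layout 2 1 {s} (s≤s (s≤s (s≤s z≤n))) (λ ()) (s≤s (s≤s z≤n)) 0<n (s≤s z≤n) N≡ refl
shift-layout s 0<n (inj₂ (inj₂ (inj₁ refl))) _ N≡ =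
  layout 2 2 {s} (s≤s (s≤s (s≤s z≤n))) (λ ()) (s≤s (s≤s (s≤s z≤n))) 0<n (s≤s (s≤s z≤n)) N≡ refl
shift-layout s 0<n (inj₂ (inj₂ (inj₂ (inj₁ refl)))) _ N≡ =
  layout 0 1 {s} (s≤s z≤n) (λ ()) (s≤s (s≤s z≤n)) 0<n 0<n N≡ refl
shift-layout s 0<n (inj₂ (inj₂ (inj₂ (inj₂ refl)))) s≤n N≡ =
  layout 0 2 {s} (s≤s z≤n) (λ ()) (s≤s (s≤s (s≤s z≤n))) 0<n (ℤP.drop‿+≤+ s≤n) N≡ refl

proposition2p2 : ∀ (n : ℕ) (s : ℤ) → 0 < n →
    (s ≡ - + 2 ⊎ s ≡ - + 1 ⊎ s ≡ + 0 ⊎ s ≡ + 1 ⊎ s ≡ + 2) →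
    s ≤ℤ + n →
    ∀ (N a b : ℕ) → + N ≡ + 3 * + n - s →
    IsAw N a → IsAw n b → a ≥ b + 1
proposition2p2 n s 0<n s-range s≤n N _ _ N≡3n-s =
  aw-lower-bound (shift-layout s 0<n s-range s≤n N≡3n-s)
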